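{- Let $A$ be a finite non-empty set of agents. For every agent $a\in A$ and every $\varphi\in\mathcal{L}_{KS}$, $\vdash_{\mathsf{SSL}}S_a\varphi\leftrightarrow K_aS_a\varphi$ and $\vdash_{\mathsf{SSL}}\neg S_a\varphi\leftrightarrow K_a\neg S_a\varphi$.
   Context: The language $\mathcal{L}_{KS}$ over a countable set $\mathsf{Prop}$ of variables and agents $A$ is $\varphi::=p\mid\neg\varphi\mid(\varphi\wedge\varphi)\mid K_a\varphi\mid S_a\varphi$. The system $\mathsf{SSL}$ has axioms: all propositional tautologies; for each $a\in A$: (K) $K_a(\varphi\to\psi)\to(K_a\varphi\to K_a\psi)$, (T) $K_a\varphi\to\varphi$, (4) $K_a\varphi\to K_aK_a\varphi$, (5) $\neg K_a\varphi\to K_a\neg K_a\varphi$, (S1) $S_a\varphi\to K_a\varphi$, (S4) $S_a\varphi\to K_aS_a\varphi$; and for distinct $a,b\in A$: (S2) $S_a\varphi\to\neg K_b\varphi$. Rules: modus ponens; from $\varphi$ infer $K_a\varphi$; from $\vdash\varphi\leftrightarrow\psi$ infer $\vdash S_a\varphi\leftrightarrow S_a\psi$. -}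

module Defs where

open import Data.Nat using (ℕ)
open import Data.Fin using (Fin)
open import Data.Bool using (Bool; true; false; not; _∧_)
open import Relation.Binary.PropositionalEquality using (_≡_; _≢_)

-- Agents: the finite set A is represented as Fin n (non-emptiness is a
-- hypothesis on n in the statement). Prop is ℕ (countable).
module _ (n : ℕ) where

  data Form : Set where
    var  : ℕ → Form
    ¬'_  : Form → Form
    _∧'_ : Form → Form → Form
    K    : Fin n → Form → Form
    S    : Fin n → Form → Form

module _ {n : ℕ} where

  infixr 5 _→'_
  _→'_ : Form n → Form n → Form n
  φ →' ψ = ¬' (φ ∧' (¬' ψ))

  _↔'_ : Form n → Form n → Form n
  φ ↔' ψ = (φ →' ψ) ∧' (ψ →' φ)

  -- Propositional evaluation: variables and modal formulas K_a φ, S_a φ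
  -- are treated as propositional atoms, interpreted by an arbitrary valuation.
  record Valuation : Set where
    field
      vVar : ℕ → Bool
      vK   : Fin n → Form n → Bool
      vS   : Fin n → Form n → Bool

  eval : Valuation → Form n → Bool
  eval v (var p)   = Valuation.vVar v p
  eval v (¬' φ)    = not (eval v φ)
  eval v (φ ∧' ψ)  = eval v φ ∧ eval v ψ
  eval v (K a φ)   = Valuation.vK v a φ
  eval v (S a φ)   = Valuation.vS v a φ

  Tautology : Form n → Set
  Tautology φ = (v : Valuation) → eval v φ ≡ true

  data ⊢SSL : Form n → Set where
    taut : ∀ {φ} → Tautology φ → ⊢SSL φ
    axK  : ∀ a φ ψ → ⊢SSL (K a (φ →' ψ) →' (K a φ →' K a ψ))
    axT  : ∀ a φ → ⊢SSL (K a φ →' φ)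
    ax4  : ∀ a φ → ⊢SSL (K a φ →' K a (K a φ))
    ax5  : ∀ a φ → ⊢SSL (¬' (K a φ) →' K a (¬' (K a φ)))
    axS1 : ∀ a φ → ⊢SSL (S a φ →' K a φ)
    axS4 : ∀ a φ → ⊢SSL (S a φ →' K a (S a φ))
    axS2 : ∀ a b φ → a ≢ b → ⊢SSL (S a φ →' ¬' (K b φ))
    mp   : ∀ {φ ψ} → ⊢SSL (φ →' ψ) → ⊢SSL φ → ⊢SSL ψ
    nec  : ∀ a {φ} → ⊢SSL φ → ⊢SSL (K a φ)
    reS  : ∀ a {φ ψ} → ⊢SSL (φ ↔' ψ) → ⊢SSL (S a φ ↔' S a ψ)

-- The positive half is axioms S4 and T. For the negative half, in any S5 logic a
-- formula φ with ⊢ φ → K φ has its negation introspective too: ¬φ → ¬Kφ by T,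
-- ¬Kφ → K¬Kφ by 5, and K¬Kφ → K¬φ because K is monotone and ¬Kφ → ¬φ.
module Submission where

open import Defs
open import Data.Nat using (ℕ; _≥_)
open import Data.Fin using (Fin)
open import Data.Product using (_×_; _,_)
open import Data.Bool using (Bool; true; false; not; _∧_)
open import Relation.Binary.PropositionalEquality using (_≡_; refl)

_⇒_ : Bool → Bool → Bool
p ⇒ q = not (p ∧ not q)

⇒-↔-intro : ∀ p q → (p ⇒ q) ⇒ ((q ⇒ p) ⇒ ((p ⇒ q) ∧ (q ⇒ p))) ≡ true
⇒-↔-intro true  true  = refl
⇒-↔-intro true  false = refl
⇒-↔-intro false true  = refl
⇒-↔-intro false false = refl

⇒-contraposition : ∀ p q → (p ⇒ q) ⇒ (not q ⇒ not p) ≡ true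
⇒-contraposition true  true  = refl
⇒-contraposition true  false = refl
⇒-contraposition false true  = refl
⇒-contraposition false false = refl

⇒-trans : ∀ p q r → (p ⇒ q) ⇒ ((q ⇒ r) ⇒ (p ⇒ r)) ≡ true
⇒-trans true  true  true  = refl
⇒-trans true  true  false = refl
⇒-trans true  false true  = refl
⇒-trans true  false false = refl
⇒-trans false true  true  = refl
⇒-trans false true  false = refl
⇒-trans false false true  = refl
⇒-trans false false false = refl

module _ {n : ℕ} where

  ↔-intro : ∀ {φ ψ : Form n} → ⊢SSL (φ →' ψ) → ⊢SSL (ψ →' φ) → ⊢SSL (φ ↔' ψ)
  ↔-intro {φ} {ψ} φ→ψ ψ→φ =
    mp (mp (taut λ v → ⇒-↔-intro (eval v φ) (eval v ψ)) φ→ψ) ψ→φ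

  contraposition : ∀ {φ ψ : Form n} → ⊢SSL (φ →' ψ) → ⊢SSL (¬' ψ →' ¬' φ)
  contraposition {φ} {ψ} φ→ψ =
    mp (taut λ v → ⇒-contraposition (eval v φ) (eval v ψ)) φ→ψ

  →-trans : ∀ {φ ψ χ : Form n} → ⊢SSL (φ →' ψ) → ⊢SSL (ψ →' χ) → ⊢SSL (φ →' χ)
  →-trans {φ} {ψ} {χ} φ→ψ ψ→χ =
    mp (mp (taut λ v → ⇒-trans (eval v φ) (eval v ψ) (eval v χ)) φ→ψ) ψ→χ

  K-mono : ∀ a {φ ψ : Form n} → ⊢SSL (φ →' ψ) → ⊢SSL (K a φ →' K a ψ)
  K-mono a {φ} {ψ} φ→ψ = mp (axK a φ ψ) (nec a φ→ψ)

  ¬-introspective : ∀ a {φ : Form n} → ⊢SSL (φ →' K a φ) → ⊢SSL (¬' φ →' K a (¬' φ))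
  ¬-introspective a {φ} φ→Kφ =
    →-trans (→-trans (contraposition (axT a φ)) (ax5 a φ))
            (K-mono a (contraposition φ→Kφ))

  introspective-↔ : ∀ a {φ : Form n} → ⊢SSL (φ →' K a φ) → ⊢SSL (φ ↔' K a φ)
  introspective-↔ a {φ} φ→Kφ = ↔-intro φ→Kφ (axT a φ)

-- Non-emptiness of the agent set is already witnessed by a : Fin n.
corollary4p4 : (n : ℕ) → n ≥ 1 → (a : Fin n) → (φ : Form n) →
    ⊢SSL (S a φ ↔' K a (S a φ)) × ⊢SSL ((¬' (S a φ)) ↔' K a (¬' (S a φ)))
corollary4p4 n _ a φ =
  introspective-↔ a (axS4 a φ) , introspective-↔ a (¬-introspective a (axS4 a φ))
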